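{- Let $p$ and $l$ be two distinct odd prime numbers. Let $c$ be an integer with $c^{l-1}\equiv 1\pmod{l^2}$, and let $a$ be an integer with $\left(\frac{a^2-c}{l}\right)=1$. Let $\sqrt{a^2-c}$ denote a square root of $a^2-c$ in $\mathbb{Z}_l^\times$. If $(a+\sqrt{a^2-c})^{l-1}\in 1+l^2\mathbb{Z}_l$, then $$\big((a+pl)+\sqrt{(a+pl)^2-c}\big)^{l-1}\notin 1+l^2\mathbb{Z}_l\quad\text{and}\quad\big((a+pl)-\sqrt{(a+pl)^2-c}\big)^{l-1}\notin 1+l^2\mathbb{Z}_l,$$ where $\sqrt{(a+pl)^2-c}$ is a square root of $(a+pl)^2-c$ in $\mathbb{Z}_l^\times$.
   Context: $\left(\frac{\cdot}{l}\right)$ is the Legendre symbol and $\mathbb{Z}_l$ the ring of $l$-adic integers. -}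

module Defs where

open import Data.Nat.Base as ℕ using (ℕ; zero; suc)
open import Data.Integer.Base using (ℤ; +_; _+_; _*_; -_; _-_; _^_; 0ℤ; 1ℤ)
open import Data.Integer.Properties using (*-zeroˡ)
open import Data.Integer.Divisibility.Signed
  using (_∣_; divides; ∣m∣n⇒∣m+n; ∣m⇒∣-m; ∣n⇒∣m*n; ∣m⇒∣m*n)
open import Data.Product using (Σ; ∃; _×_; _,_)
open import Relation.Nullary using (¬_)
open import Relation.Binary.PropositionalEquality using (_≡_; refl; sym; subst)
open import Data.Integer.Tactic.RingSolver using (solve-∀)

private
  ∣-resp : ∀ {k a b} → k ∣ a → a ≡ b → k ∣ b
  ∣-resp {k} d e = subst (k ∣_) e d

  ∣0 : ∀ k → k ∣ 0ℤ
  ∣0 k = divides 0ℤ (sym (*-zeroˡ k))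

  e-self : ∀ z → 0ℤ ≡ z - z
  e-self = solve-∀

  e-add : ∀ a b c d → (a - c) + (b - d) ≡ (a + b) - (c + d)
  e-add = solve-∀

  e-neg : ∀ a c → - (a - c) ≡ (- a) - (- c)
  e-neg = solve-∀

  e-mul : ∀ a b c d → a * (b - d) + (a - c) * d ≡ (a * b) - (c * d)
  e-mul = solve-∀

-- The ring ℤ_l of l-adic integers, as the inverse limit of the ℤ/l^n ℤ:
-- a coherent sequence of integers (seq n is a representative of the
-- residue class mod l^n), with  seq (n+1) ≡ seq n  (mod l^n).

record ℤ[_] (l : ℕ) : Set where
  constructor mkℤₗ
  field
    seq : ℕ → ℤ
    coh : ∀ n → (+ l) ^ n ∣ seq (suc n) - seq n
open ℤ[_] public

module _ {l : ℕ} where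

  infix 4 _≈ₗ_
  _≈ₗ_ : ℤ[ l ] → ℤ[ l ] → Set
  x ≈ₗ y = ∀ n → (+ l) ^ n ∣ seq x n - seq y n

  ι : ℤ → ℤ[ l ]
  ι z = mkℤₗ (λ _ → z) (λ n → ∣-resp (∣0 ((+ l) ^ n)) (e-self z))

  infixl 6 _+ₗ_ _-ₗ_
  infixl 7 _*ₗ_
  infixr 8 _^ₗ_

  _+ₗ_ : ℤ[ l ] → ℤ[ l ] → ℤ[ l ]
  x +ₗ y = mkℤₗ (λ n → seq x n + seq y n)
    (λ n → ∣-resp (∣m∣n⇒∣m+n (coh x n) (coh y n))
                  (e-add (seq x (suc n)) (seq y (suc n)) (seq x n) (seq y n)))

  -ₗ_ : ℤ[ l ] → ℤ[ l ]
  -ₗ x = mkℤₗ (λ n → - seq x n)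
    (λ n → ∣-resp (∣m⇒∣-m (coh x n)) (e-neg (seq x (suc n)) (seq x n)))

  _-ₗ_ : ℤ[ l ] → ℤ[ l ] → ℤ[ l ]
  x -ₗ y = x +ₗ (-ₗ y)

  _*ₗ_ : ℤ[ l ] → ℤ[ l ] → ℤ[ l ]
  x *ₗ y = mkℤₗ (λ n → seq x n * seq y n)
    (λ n → ∣-resp (∣m∣n⇒∣m+n (∣n⇒∣m*n (seq x (suc n)) (coh y n))
                             (∣m⇒∣m*n (seq y n) (coh x n)))
                  (e-mul (seq x (suc n)) (seq y (suc n)) (seq x n) (seq y n)))

  _^ₗ_ : ℤ[ l ] → ℕ → ℤ[ l ]
  x ^ₗ zero  = ι 1ℤ
  x ^ₗ suc k = x *ₗ (x ^ₗ k)

  IsUnit : ℤ[ l ] → Set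
  IsUnit x = ¬ ((+ l) ∣ seq x 1)

  In1+l²ℤₗ : ℤ[ l ] → Set
  In1+l²ℤₗ x = Σ ℤ[ l ] λ y → x ≈ₗ ι 1ℤ +ₗ ι ((+ l) ^ 2) *ₗ y

LegendreIsOne : ℕ → ℤ → Set
LegendreIsOne l x = ¬ ((+ l) ∣ x) × ∃ λ y → (+ l) ∣ y * y - x

module Submission where

-- Everything in the statement only matters modulo l², so the proof works with
-- the level-2 representatives  σ = s mod l²,  τ = t mod l²  (integers) and
-- congruences modulo l².  Writing  x = a + σ,  the hypotheses say
--   σ² ≡ a² - c,   x^(l-1) ≡ 1,   c^(l-1) ≡ 1,   τ² ≡ (a+pl)² - c   (mod l²).
--
--  * τ² ≡ σ² (mod l), so τ ≡ ±σ (mod l).  Replacing σ by -σ is harmless: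
--    (a+σ)(a-σ) ≡ c forces (a-σ)^(l-1) ≡ 1 as well.  So assume τ = σ + u·l.
--  * Comparing τ² with σ² modulo l² gives  σu ≡ ap  (mod l)  (as l ∤ 2).
--  * (a+pl+τ) = x + l(p+u), and  (x + lw)^m ≡ x^m + m·x^(m-1)·lw  (mod l²);
--    with x^m ≡ 1 and l ∤ m x, the power ≡ 1 would force l ∣ w = p + u.
--  * Then  p·x = σ(p+u) - (σu - ap) ≡ 0 (mod l), impossible as l ∤ p, l ∤ x.

open import Defs
open import Data.Nat.Base using (ℕ; _∸_; zero; suc)
import Data.Nat.Divisibility as ℕ
open import Data.Nat.Primality
  using (Prime; euclidsLemma; prime⇒irreducible; prime⇒nonZero; prime[2]; ¬prime[0]; ¬prime[1])
open import Data.Nat.Properties using (n<1+n)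
open import Data.Integer.Base using (ℤ; +_; _+_; _*_; _-_; -_; _^_; 0ℤ; 1ℤ)
open import Data.Integer.Properties using (abs-*; *-identityʳ)
open import Data.Integer.Divisibility.Signed
open import Data.Integer.Divisibility as Unsigned using ()
open import Data.Integer.Tactic.RingSolver using (solve-∀)
open import Data.Product using (_×_; _,_)
open import Data.Sum using (_⊎_; inj₁; inj₂; [_,_]′; map₂)
open import Data.Empty using (⊥-elim)
open import Relation.Nullary using (¬_)
open import Relation.Binary.PropositionalEquality
  using (_≡_; _≢_; refl; sym; trans; cong; subst; module ≡-Reasoning)

infix 4 _≡_mod_
_≡_mod_ : ℤ → ℤ → ℤ → Set
_≡_mod_ x y n = n ∣ x - y

∣-by : ∀ {k a b} → k ∣ a → a ≡ b → k ∣ b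
∣-by {k} k∣a a≡b = subst (k ∣_) a≡b k∣a

^-distrib-* : ∀ x y k → (x * y) ^ k ≡ x ^ k * y ^ k
^-distrib-* x y zero    = refl
^-distrib-* x y (suc k) = begin
  x * y * (x * y) ^ k        ≡⟨ cong (x * y *_) (^-distrib-* x y k) ⟩
  x * y * (x ^ k * y ^ k)    ≡⟨ e x y (x ^ k) (y ^ k) ⟩
  x * x ^ k * (y * y ^ k)    ∎
  where
  open ≡-Reasoning
  e : ∀ x y X Y → x * y * (X * Y) ≡ x * X * (y * Y)
  e = solve-∀

module Congruence {n : ℤ} where

  mod-trans : ∀ {x y z} → x ≡ y mod n → y ≡ z mod n → x ≡ z mod n
  mod-trans {x} {y} {z} x≡y y≡z = ∣-by (∣m∣n⇒∣m+n x≡y y≡z) (e x y z)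
    where
    e : ∀ x y z → (x - y) + (y - z) ≡ x - z
    e = solve-∀

  mod-* : ∀ {x x′ y y′} → x ≡ y mod n → x′ ≡ y′ mod n →
          x * x′ ≡ y * y′ mod n
  mod-* {x} {x′} {y} {y′} x≡y x′≡y′ =
    ∣-by (∣m∣n⇒∣m+n (∣n⇒∣m*n x x′≡y′) (∣m⇒∣m*n y′ x≡y)) (e x x′ y y′)
    where
    e : ∀ x x′ y y′ → x * (x′ - y′) + (x - y) * y′ ≡ x * x′ - y * y′
    e = solve-∀

  mod-^ : ∀ {x y} k → x ≡ y mod n → x ^ k ≡ y ^ k mod n
  mod-^ zero            x≡y = divides 0ℤ refl
  mod-^ {x} {y} (suc k) x≡y = mod-* {x} {x ^ k} {y} {y ^ k} x≡y (mod-^ k x≡y)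

  cancel-one : ∀ {X Y} → X ≡ 1ℤ mod n → X * Y ≡ 1ℤ mod n → Y ≡ 1ℤ mod n
  cancel-one {X} {Y} X≡1 XY≡1 = ∣-by (∣m∣n⇒∣m-n XY≡1 (∣n⇒∣m*n Y X≡1)) (e X Y)
    where
    e : ∀ X Y → X * Y - 1ℤ - Y * (X - 1ℤ) ≡ Y - 1ℤ
    e = solve-∀

  -- The conjugate of a root of norm c:  if σ² ≡ a² - c then (a+σ)(a-σ) ≡ c,
  -- so when c and a+σ have m-th power ≡ 1, so does a-σ.
  conjugate-power-one : ∀ {a c σ} m → σ * σ ≡ a * a - c mod n →
    (a + σ) ^ m ≡ 1ℤ mod n → c ^ m ≡ 1ℤ mod n → (a - σ) ^ m ≡ 1ℤ mod n
  conjugate-power-one {a} {c} {σ} m σ² x^m≡1 c^m≡1 =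
    cancel-one {(a + σ) ^ m} x^m≡1
      (subst (_≡ 1ℤ mod n) (^-distrib-* (a + σ) (a - σ) m)
             (mod-trans {((a + σ) * (a - σ)) ^ m} (mod-^ m norm) c^m≡1))
    where
    e : ∀ a c σ → - (σ * σ - (a * a - c)) ≡ (a + σ) * (a - σ) - c
    e = solve-∀
    norm : (a + σ) * (a - σ) ≡ c mod n
    norm = ∣-by (∣m⇒∣-m σ²) (e a c σ)

first-order-binomial : ∀ L x w k →
  (x + L * w) ^ suc k ≡ x ^ suc k + + suc k * x ^ k * L * w mod L * L
first-order-binomial L x w zero = ∣-by (divides 0ℤ refl) (e L x w)
  where
  e : ∀ L x w → 0ℤ ≡ (x + L * w) * 1ℤ - (x * 1ℤ + 1ℤ * 1ℤ * L * w)
  e = solve-∀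
first-order-binomial L x w (suc k) =
  ∣-by (∣m∣n⇒∣m+n (∣n⇒∣m*n (x + L * w) (first-order-binomial L x w k))
                  (∣m⇒∣m*n (+ suc k * x ^ k * w * w) ∣-refl))
       (e L x w (x ^ k) (+ suc k) ((x + L * w) ^ suc k))
  where
  e : ∀ L x w X N Y →
      (x + L * w) * (Y - (x * X + N * X * L * w)) + L * L * (N * X * w * w)
      ≡ (x + L * w) * Y - (x * (x * X) + (1ℤ + N) * (x * X) * L * w)
  e = solve-∀

module ModPrime (l : ℕ) (l-prime : Prime l) where
  open Congruence

  L : ℤ
  L = + l

  L² : ℤ
  L² = L * L

  euclid : ∀ x y → L ∣ x * y → L ∣ x ⊎ L ∣ y
  euclid x y L∣xy
    with euclidsLemma _ _ l-prime (subst (l ℕ.∣_) (abs-* x y) (∣⇒∣ᵤ L∣xy))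
  ... | inj₁ l∣x = inj₁ (∣ᵤ⇒∣ l∣x)
  ... | inj₂ l∣y = inj₂ (∣ᵤ⇒∣ l∣y)

  L∤1 : ¬ L ∣ 1ℤ
  L∤1 L∣1 = ¬prime[1] (subst Prime (ℕ.∣1⇒≡1 (∣⇒∣ᵤ L∣1)) l-prime)

  L∣L* : ∀ z → L ∣ L * z
  L∣L* z = ∣m⇒∣m*n z ∣-refl

  mod-L²⇒mod-L : ∀ {x y} → x ≡ y mod L² → x ≡ y mod L
  mod-L²⇒mod-L = ∣-trans (L∣L* L)

  cancel-L : ∀ {z} → L² ∣ L * z → L ∣ z
  cancel-L L²∣Lz =
    ∣ᵤ⇒∣ (Unsigned.*-cancelˡ-∣ L {{prime⇒nonZero l-prime}} (∣⇒∣ᵤ L²∣Lz))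

  ∤-^ : ∀ {x} k → ¬ L ∣ x → ¬ L ∣ x ^ k
  ∤-^ zero    L∤x L∣1 = L∤1 L∣1
  ∤-^ {x} (suc k) L∤x L∣x^k+1 with euclid x (x ^ k) L∣x^k+1
  ... | inj₁ L∣x   = L∤x L∣x
  ... | inj₂ L∣x^k = ∤-^ k L∤x L∣x^k

  power-one⇒unit : ∀ {x} k → x ^ suc k ≡ 1ℤ mod L → ¬ L ∣ x
  power-one⇒unit {x} k x^k+1≡1 L∣x = L∤1 (∣-by (∣m∣n⇒∣m-n L∣x^k+1 x^k+1≡1) (e (x ^ suc k)))
    where
    e : ∀ X → X - (X - 1ℤ) ≡ 1ℤ
    e = solve-∀
    L∣x^k+1 : L ∣ x ^ suc k
    L∣x^k+1 = ∣m⇒∣m*n (x ^ k) L∣x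

  roots-up-to-sign : ∀ {σ τ} → τ * τ ≡ σ * σ mod L →
    τ ≡ σ mod L ⊎ τ ≡ - σ mod L
  roots-up-to-sign {σ} {τ} τ²≡σ² =
    map₂ (λ L∣τ+σ → ∣-by L∣τ+σ (e₂ σ τ)) (euclid (τ - σ) (τ + σ) (∣-by τ²≡σ² (e₁ σ τ)))
    where
    e₁ : ∀ σ τ → τ * τ - σ * σ ≡ (τ - σ) * (τ + σ)
    e₁ = solve-∀
    e₂ : ∀ σ τ → τ + σ ≡ τ - (- σ)
    e₂ = solve-∀

  linear-coefficient : ∀ {x w} k → x ^ suc k ≡ 1ℤ mod L² →
    (x + L * w) ^ suc k ≡ 1ℤ mod L² → L ∣ + suc k * x ^ k * w
  linear-coefficient {x} {w} k x^m≡1 y^m≡1 =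
    cancel-L (∣-by (∣m∣n⇒∣m-n (∣m∣n⇒∣m-n y^m≡1 (first-order-binomial L x w k)) x^m≡1)
                   (e L ((x + L * w) ^ suc k) (x ^ suc k) (+ suc k * x ^ k) w))
    where
    e : ∀ L Y Z M w → Y - 1ℤ - (Y - (Z + M * L * w)) - (Z - 1ℤ) ≡ L * (M * w)
    e = solve-∀

  rigidity : ∀ {x w} k → ¬ L ∣ + suc k → ¬ L ∣ x →
    x ^ suc k ≡ 1ℤ mod L² → (x + L * w) ^ suc k ≡ 1ℤ mod L² → L ∣ w
  rigidity {x} {w} k L∤m L∤x x^m≡1 y^m≡1 =
    [ (λ L∣mX → [ (λ L∣m → ⊥-elim (L∤m L∣m)) , (λ L∣X → ⊥-elim (∤-^ k L∤x L∣X)) ]′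
                  (euclid (+ suc k) (x ^ k) L∣mX))
    , (λ L∣w → L∣w) ]′
    (euclid (+ suc k * x ^ k) w (linear-coefficient k x^m≡1 y^m≡1))

  -- Comparing the two square roots modulo l²: if τ = σ + ul, then
  -- τ² - σ² ≡ (a+pl)² - a² yields  σu ≡ ap  (mod l).
  cross-term : ∀ {P a c σ} u → ¬ L ∣ + 2 →
    σ * σ ≡ a * a - c mod L² →
    (σ + u * L) * (σ + u * L) ≡ (a + P * L) * (a + P * L) - c mod L² →
    L ∣ σ * u - a * P
  cross-term {P} {a} {c} {σ} u L∤2 σ² τ² =
    [ (λ L∣2 → ⊥-elim (L∤2 L∣2)) , (λ L∣σu-aP → L∣σu-aP) ]′
    (euclid (+ 2) (σ * u - a * P) (∣m+n∣n⇒∣m L∣2[σu-aP]+L[u²-P²] (L∣L* (u * u - P * P))))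
    where
    e : ∀ L σ u a P c →
        ((σ + u * L) * (σ + u * L) - ((a + P * L) * (a + P * L) - c)) - (σ * σ - (a * a - c))
        ≡ L * (+ 2 * (σ * u - a * P) + L * (u * u - P * P))
    e = solve-∀
    L∣2[σu-aP]+L[u²-P²] : L ∣ + 2 * (σ * u - a * P) + L * (u * u - P * P)
    L∣2[σu-aP]+L[u²-P²] = cancel-L (∣-by (∣m∣n⇒∣m-n τ² σ²) (e L σ u a P c))

  -- The heart of the argument, for a root τ = σ + ul congruent to σ mod l:
  -- rigidity gives l ∣ p + u, and then the cross term gives l ∣ p(a + σ).
  same-root-case : ∀ {P a c σ} m u → ¬ L ∣ + m → ¬ L ∣ + 2 → ¬ L ∣ P →
    σ * σ ≡ a * a - c mod L² → (a + σ) ^ m ≡ 1ℤ mod L² →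
    (σ + u * L) * (σ + u * L) ≡ (a + P * L) * (a + P * L) - c mod L² →
    ¬ (a + P * L + (σ + u * L)) ^ m ≡ 1ℤ mod L²
  same-root-case zero u L∤m _ _ _ _ _ _ = L∤m (divides 0ℤ refl)
  same-root-case {P} {a} {c} {σ} (suc k) u L∤m L∤2 L∤P σ² x^m≡1 τ² y^m≡1 =
    [ L∤P , L∤x ]′ (euclid P (a + σ) L∣P[a+σ])
    where
    e₁ : ∀ L a P σ u → a + P * L + (σ + u * L) ≡ a + σ + L * (P + u)
    e₁ = solve-∀
    e₂ : ∀ σ P u a → σ * (P + u) - (σ * u - a * P) ≡ P * (a + σ)
    e₂ = solve-∀
    L∤x : ¬ L ∣ a + σ
    L∤x = power-one⇒unit k (mod-L²⇒mod-L {(a + σ) ^ suc k} x^m≡1)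
    L∣P+u : L ∣ P + u
    L∣P+u = rigidity k L∤m L∤x x^m≡1
              (subst (λ z → z ^ suc k ≡ 1ℤ mod L²) (e₁ L a P σ u) y^m≡1)
    L∣P[a+σ] : L ∣ P * (a + σ)
    L∣P[a+σ] = ∣-by (∣m∣n⇒∣m-n (∣n⇒∣m*n σ L∣P+u) (cross-term {P} {a} {c} {σ} u L∤2 σ² τ²)) (e₂ σ P u a)

  congruent-root-case : ∀ {P a c σ τ} m → ¬ L ∣ + m → ¬ L ∣ + 2 → ¬ L ∣ P →
    σ * σ ≡ a * a - c mod L² → (a + σ) ^ m ≡ 1ℤ mod L² → τ ≡ σ mod L →
    τ * τ ≡ (a + P * L) * (a + P * L) - c mod L² →
    ¬ (a + P * L + τ) ^ m ≡ 1ℤ mod L²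
  congruent-root-case {P} {a} {c} {σ} {τ} m L∤m L∤2 L∤P σ² x^m≡1 (divides u τ-σ≡uL) =
    subst (λ τ → τ * τ ≡ (a + P * L) * (a + P * L) - c mod L² →
                 ¬ (a + P * L + τ) ^ m ≡ 1ℤ mod L²)
          (sym τ≡σ+uL) (same-root-case {P} {a} {c} {σ} m u L∤m L∤2 L∤P σ² x^m≡1)
    where
    e : ∀ σ τ → τ ≡ σ + (τ - σ)
    e = solve-∀
    τ≡σ+uL : τ ≡ σ + u * L
    τ≡σ+uL = trans (e σ τ) (cong (λ z → σ + z) τ-σ≡uL)

  level-two-theorem : ∀ {P a c σ τ} m → ¬ L ∣ + m → ¬ L ∣ + 2 → ¬ L ∣ P →
    c ^ m ≡ 1ℤ mod L² → σ * σ ≡ a * a - c mod L² → (a + σ) ^ m ≡ 1ℤ mod L² →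
    τ * τ ≡ (a + P * L) * (a + P * L) - c mod L² →
    ¬ (a + P * L + τ) ^ m ≡ 1ℤ mod L²
  level-two-theorem {P} {a} {c} {σ} {τ} m L∤m L∤2 L∤P c^m≡1 σ² x^m≡1 τ² =
    [ (λ τ≡σ → congruent-root-case {P} {a} {c} {σ} m L∤m L∤2 L∤P σ² x^m≡1 τ≡σ τ²)
    , (λ τ≡-σ → congruent-root-case {P} {a} {c} { - σ} m L∤m L∤2 L∤P [-σ]² x′^m≡1 τ≡-σ τ²)
    ]′ (roots-up-to-sign {σ} {τ} τ²≡σ²)
    where
    e : ∀ L τ σ a P c →
        τ * τ - ((a + P * L) * (a + P * L) - c) - (σ * σ - (a * a - c))
        + L * (P * (+ 2 * a + P * L)) ≡ τ * τ - σ * σ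
    e = solve-∀
    τ²≡σ² : τ * τ ≡ σ * σ mod L
    τ²≡σ² = ∣-by (∣m∣n⇒∣m+n (mod-L²⇒mod-L {τ * τ - ((a + P * L) * (a + P * L) - c)}
                                         (∣m∣n⇒∣m-n τ² σ²))
                            (L∣L* (P * (+ 2 * a + P * L))))
                 (e L τ σ a P c)
    e′ : ∀ σ N → σ * σ - N ≡ - σ * - σ - N
    e′ = solve-∀
    [-σ]² : - σ * - σ ≡ a * a - c mod L²
    [-σ]² = ∣-by σ² (e′ σ (a * a - c))
    x′^m≡1 : (a - σ) ^ m ≡ 1ℤ mod L²
    x′^m≡1 = conjugate-power-one {L²} {a} {c} {σ} m σ² x^m≡1 c^m≡1

prime∤prime : ∀ {l q} → Prime l → Prime q → l ≢ q → ¬ + l ∣ + q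
prime∤prime l-prime q-prime l≢q l∣q =
  [ (λ l≡1 → ¬prime[1] (subst Prime l≡1 l-prime)) , l≢q ]′
  (prime⇒irreducible q-prime (∣⇒∣ᵤ l∣q))

prime∤pred : ∀ {l} → Prime l → ¬ + l ∣ + (l ∸ 1)
prime∤pred {zero}        l-prime = ⊥-elim (¬prime[0] l-prime)
prime∤pred {suc zero}    l-prime = ⊥-elim (¬prime[1] l-prime)
prime∤pred {suc (suc k)} _ l∣k+1 = ℕ.>⇒∤ (n<1+n (suc k)) (∣⇒∣ᵤ l∣k+1)

module LevelTwo {l : ℕ} where

  seq-^ : ∀ (x : ℤ[ l ]) n k → seq (x ^ₗ k) n ≡ seq x n ^ k
  seq-^ x n zero    = refl
  seq-^ x n (suc k) = cong (seq x n *_) (seq-^ x n k)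

  -- (+ l) ^ 2 unfolds to l · (l · 1), which is l · l.
  square-modulus : ∀ {z} → (+ l) ^ 2 ∣ z → (+ l * + l) ∣ z
  square-modulus {z} = subst (_∣ z) (cong (+ l *_) (*-identityʳ (+ l)))

  ≈ₗ⇒level-two : ∀ {x y : ℤ[ l ]} → x ≈ₗ y → seq x 2 ≡ seq y 2 mod (+ l * + l)
  ≈ₗ⇒level-two x≈y = square-modulus (x≈y 2)

  power-in-1+l²⇒level-two : ∀ (x : ℤ[ l ]) k → In1+l²ℤₗ (x ^ₗ k) →
    seq x 2 ^ k ≡ 1ℤ mod (+ l * + l)
  power-in-1+l²⇒level-two x k (y , x^k≈1+l²y) =
    subst (_≡ 1ℤ mod (+ l * + l)) (seq-^ x 2 k)
      (square-modulus (∣-by (∣m∣n⇒∣m+n (x^k≈1+l²y 2) (∣m⇒∣m*n (seq y 2) ∣-refl))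
                            (e (seq (x ^ₗ k) 2) ((+ l) ^ 2) (seq y 2))))
    where
    e : ∀ X N y → X - (1ℤ + N * y) + N * y ≡ X - 1ℤ
    e = solve-∀

  negate-root : ∀ {t : ℤ[ l ]} {z} → t *ₗ t ≈ₗ ι z → (-ₗ t) *ₗ (-ₗ t) ≈ₗ ι z
  negate-root {t} {z} t²≈z n = ∣-by (t²≈z n) (e (seq t n) z)
    where
    e : ∀ τ z → τ * τ - z ≡ - τ * - τ - z
    e = solve-∀

-- Both roots (a+pl) ± √((a+pl)² - c) are excluded by the level-two theorem,
-- the second being (a+pl) + t for the other square root -t.
lemma3p2 : (p l : ℕ) → Prime p → Prime l → p ≢ 2 → l ≢ 2 → p ≢ l →
    (c a : ℤ) →
    (+ l) ^ 2 ∣ c ^ (l ∸ 1) - 1ℤ →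
    LegendreIsOne l (a * a - c) →
    (s : ℤ[ l ]) → IsUnit s → s *ₗ s ≈ₗ ι (a * a - c) →
    In1+l²ℤₗ ((ι a +ₗ s) ^ₗ (l ∸ 1)) →
    (t : ℤ[ l ]) → IsUnit t →
    t *ₗ t ≈ₗ ι ((a + + p * + l) * (a + + p * + l) - c) →
    ¬ In1+l²ℤₗ ((ι (a + + p * + l) +ₗ t) ^ₗ (l ∸ 1))
    × ¬ In1+l²ℤₗ ((ι (a + + p * + l) -ₗ t) ^ₗ (l ∸ 1))
lemma3p2 p l p-prime l-prime _ l≢2 p≢l c a c^m≡1 _ s _ s² x^m∈1+l² t _ t² =
  excluded t t² , excluded (-ₗ t) (negate-root {t = t} t²)
  where
  open ModPrime l l-prime
  open LevelTwo {l}
  b : ℤ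
  b = a + + p * L
  excluded : (τ : ℤ[ l ]) → τ *ₗ τ ≈ₗ ι (b * b - c) →
             ¬ In1+l²ℤₗ ((ι b +ₗ τ) ^ₗ (l ∸ 1))
  excluded τ τ² y^m∈1+l² =
    level-two-theorem {+ p} {a} {c} {seq s 2} {seq τ 2} (l ∸ 1)
      (prime∤pred l-prime) (prime∤prime l-prime prime[2] l≢2)
      (prime∤prime l-prime p-prime (λ l≡p → p≢l (sym l≡p)))
      (square-modulus c^m≡1) (≈ₗ⇒level-two {s *ₗ s} {ι (a * a - c)} s²)
      (power-in-1+l²⇒level-two (ι a +ₗ s) (l ∸ 1) x^m∈1+l²)
      (≈ₗ⇒level-two {τ *ₗ τ} {ι (b * b - c)} τ²)
      (power-in-1+l²⇒level-two (ι b +ₗ τ) (l ∸ 1) y^m∈1+l²)
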